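{- Let $M=(\mathbf{K}^{\mathbf{n}},\rho)$ be a sum-matroid with nullity function $\eta$, and let $d_i=d^S_i(M)$, $i=1,\dots,\eta(\mathbf{K}^{\mathbf{n}})$, be its generalized weights. Then $d_1<d_2<\cdots<d_{\eta(\mathbf{K}^{\mathbf{n}})}$.
   Context: Fix positive integers $\ell,n_1,\dots,n_\ell$ and finite fields $K_1,\dots,K_\ell$. $\mathbf{K}^{\mathbf{n}}=(K_1^{n_1},\dots,K_\ell^{n_\ell})$; $\mathcal{P}(\mathbf{K}^{\mathbf{n}})$ is the lattice of tuples $\mathcal{L}=(\mathcal{L}_1,\dots,\mathcal{L}_\ell)$ with $\mathcal{L}_i$ a $K_i$-subspace of $K_i^{n_i}$, under componentwise inclusion, intersection and sum; $\mathrm{Rk}(\mathcal{L})=\sum_i\dim_{K_i}\mathcal{L}_i$. A sum-matroid is $(\mathbf{K}^{\mathbf{n}},\rho)$ with $\rho:\mathcal{P}(\mathbf{K}^{\mathbf{n}})\to\mathbb{Z}_{\ge0}$ satisfying (R1) $0\le\rho(\mathcal{L})\le\mathrm{Rk}(\mathcal{L})$, (R2) monotonicity under inclusion, (R3) $\rho(\mathcal{L}+\mathcal{L}')+\rho(\mathcal{L}\cap\mathcal{L}')\le\rho(\mathcal{L})+\rho(\mathcal{L}')$. Nullity: $\eta(\mathcal{L})=\mathrm{Rk}(\mathcal{L})-\rho(\mathcal{L})$. Generalized weights: $d^S_i(M)=\min\{\mathrm{Rk}(\mathcal{L}):\eta(\mathcal{L})=i\}$ for $i=1,\dots,\eta(\mathbf{K}^{\mathbf{n}})$.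 -}

module Defs where

open import Level using (Level; _⊔_) renaming (suc to lsuc)
open import Algebra.Bundles using (CommutativeRing)
open import Data.Nat using (ℕ; zero; suc; _∸_; _≤_; _<_) renaming (_+_ to _+ℕ_)
open import Data.Fin using (Fin; zero; suc)
open import Data.Product using (Σ; ∃; _×_; _,_)
open import Relation.Nullary using (¬_)
open import Relation.Binary.PropositionalEquality using (_≡_)

record FiniteField (c ℓ : Level) : Set (lsuc (c ⊔ ℓ)) where
  field
    commRing   : CommutativeRing c ℓ
  open CommutativeRing commRing public
  field
    0≉1        : ¬ (0# ≈ 1#)
    inverse    : ∀ x → ¬ (x ≈ 0#) → ∃ λ y → x * y ≈ 1#
    size       : ℕ
    enum       : Fin size → Carrier
    enum-surj  : ∀ x → ∃ λ j → enum j ≈ x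

Σℕ : (k : ℕ) → (Fin k → ℕ) → ℕ
Σℕ zero    f = 0
Σℕ (suc k) f = f zero +ℕ Σℕ k (λ j → f (suc j))

module LinAlg {c ℓ : Level} (K : FiniteField c ℓ) where
  open FiniteField K using (Carrier; _≈_; _+_; _*_; 0#)

  Vec : ℕ → Set c
  Vec n = Fin n → Carrier

  _≈ᵥ_ : ∀ {n} → Vec n → Vec n → Set ℓ
  u ≈ᵥ v = ∀ i → u i ≈ v i

  0ᵥ : ∀ {n} → Vec n
  0ᵥ _ = 0#

  _+ᵥ_ : ∀ {n} → Vec n → Vec n → Vec n
  (u +ᵥ v) i = u i + v i

  _·_ : ∀ {n} → Carrier → Vec n → Vec n
  (a · v) i = a * v i

  lincomb : ∀ {n} (d : ℕ) → (Fin d → Carrier) → (Fin d → Vec n) → Vec n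
  lincomb zero    a vs = 0ᵥ
  lincomb (suc d) a vs = (a zero · vs zero) +ᵥ lincomb d (λ j → a (suc j)) (λ j → vs (suc j))

  LinIndep : ∀ {n} (d : ℕ) → (Fin d → Vec n) → Set (c ⊔ ℓ)
  LinIndep d vs = ∀ a → lincomb d a vs ≈ᵥ 0ᵥ → ∀ j → a j ≈ 0#

  record Subspace (n : ℕ) : Set (c ⊔ ℓ) where
    field
      dim   : ℕ
      basis : Fin dim → Vec n
      indep : LinIndep dim basis

  _∈_ : ∀ {n} → Vec n → Subspace n → Set (c ⊔ ℓ)
  v ∈ L = ∃ λ a → v ≈ᵥ lincomb (Subspace.dim L) a (Subspace.basis L)

module SumMatroid {c ℓ : Level} (l : ℕ) (K : Fin l → FiniteField c ℓ) (n : Fin l → ℕ) where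
  open LinAlg

  Tuple : Set (c ⊔ ℓ)
  Tuple = (i : Fin l) → Subspace (K i) (n i)


  _⊆_ : Tuple → Tuple → Set (c ⊔ ℓ)
  L ⊆ L' = ∀ i (v : Vec (K i) (n i)) → _∈_ (K i) v (L i) → _∈_ (K i) v (L' i)

  IsIntersection : Tuple → Tuple → Tuple → Set (c ⊔ ℓ)
  IsIntersection L L' I = ∀ i (v : Vec (K i) (n i)) →
    (_∈_ (K i) v (I i) → _∈_ (K i) v (L i) × _∈_ (K i) v (L' i)) ×
    (_∈_ (K i) v (L i) × _∈_ (K i) v (L' i) → _∈_ (K i) v (I i))

  SumOf : ∀ i → Subspace (K i) (n i) → Subspace (K i) (n i) → Vec (K i) (n i) → Set (c ⊔ ℓ)
  SumOf i A B v = ∃ λ a → ∃ λ b → _∈_ (K i) a A × _∈_ (K i) b B × _≈ᵥ_ (K i) v (_+ᵥ_ (K i) a b)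

  IsSum : Tuple → Tuple → Tuple → Set (c ⊔ ℓ)
  IsSum L L' S = ∀ i (v : Vec (K i) (n i)) →
    (_∈_ (K i) v (S i) → SumOf i (L i) (L' i) v) ×
    (SumOf i (L i) (L' i) v → _∈_ (K i) v (S i))

  IsWhole : Tuple → Set (c ⊔ ℓ)
  IsWhole E = ∀ i (v : Vec (K i) (n i)) → _∈_ (K i) v (E i)

  Rk : Tuple → ℕ
  Rk L = Σℕ l (λ i → Subspace.dim (L i))

  record IsSumMatroid (ρ : Tuple → ℕ) : Set (c ⊔ ℓ) where
    field
      R1 : ∀ L → ρ L ≤ Rk L        -- (0 ≤ ρ L is automatic in ℕ)
      R2 : ∀ L L' → L ⊆ L' → ρ L ≤ ρ L'
      R3 : ∀ L L' S I → IsSum L L' S → IsIntersection L L' I →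
           ρ S +ℕ ρ I ≤ ρ L +ℕ ρ L'

  η : (Tuple → ℕ) → Tuple → ℕ
  η ρ L = Rk L ∸ ρ L

  IsGenWeight : (Tuple → ℕ) → ℕ → ℕ → Set (c ⊔ ℓ)
  IsGenWeight ρ i d =
    (∃ λ L → η ρ L ≡ i × Rk L ≡ d) × (∀ L → η ρ L ≡ i → d ≤ Rk L)

-- If L has nullity j and i < j, remove basis vectors from L one at a time.
-- Each removal lowers the rank by exactly one and, since ρ is monotone,
-- lowers the nullity by at most one; so before the rank is exhausted the
-- nullity passes through i, at some L' ⊆ L of strictly smaller rank.
-- Hence d_i ≤ Rk L' < Rk L = d_j.
module Submission where

open import Defs
open import Level using (Level)
open import Data.Nat using (ℕ; zero; suc; pred; _∸_; _≤_; _<_; z≤n)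
  renaming (_+_ to _+ℕ_)
open import Data.Nat.Properties
  using (<-trans; ≤-<-trans; <-≤-trans; <⇒≤pred; ∸-monoʳ-≤; ∸-+-assoc; m∸n≤m;
         pred[m∸n]≡m∸[1+n]; m≤n⇒m<n∨m≡n; n<1+n; module ≤-Reasoning)
open import Data.Nat.Induction using (<-wellFounded)
open import Induction.WellFounded using (Acc; acc)
open import Data.Fin using (Fin; zero; suc)
open import Data.Product using (∃; _×_; _,_)
open import Data.Sum using (_⊎_; inj₁; inj₂; [_,_])
open import Function using (_∘_)
open import Relation.Binary.PropositionalEquality
  using (_≡_; refl; sym; trans; cong; subst)

module _ {c ℓ : Level} (K : FiniteField c ℓ) where
  open FiniteField K using (Carrier; 0#; zeroˡ; +-identityˡ; +-cong)
    renaming (refl to ≈-refl; sym to ≈-sym; trans to ≈-trans)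
  open LinAlg K

  private
    prependZero : ∀ {d} → (Fin d → Carrier) → Fin (suc d) → Carrier
    prependZero a zero    = 0#
    prependZero a (suc j) = a j

    lincomb-prependZero : ∀ {m} d a (vs : Fin (suc d) → Vec m) →
      lincomb (suc d) (prependZero a) vs ≈ᵥ lincomb d a (vs ∘ suc)
    lincomb-prependZero d a vs i = ≈-trans (+-cong (zeroˡ _) ≈-refl) (+-identityˡ _)

  dropFirst : ∀ {m} → Subspace m → Subspace m
  dropFirst S@record { dim = zero } = S
  dropFirst record { dim = suc d ; basis = b ; indep = ind } = record
    { dim   = d
    ; basis = b ∘ suc
    ; indep = λ a a·b≈0 j →
        ind (prependZero a) (λ i → ≈-trans (lincomb-prependZero d a b i) (a·b≈0 i)) (suc j)
    }

  dim-dropFirst : ∀ {m} (S : Subspace m) → Subspace.dim (dropFirst S) ≡ pred (Subspace.dim S)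
  dim-dropFirst record { dim = zero }  = refl
  dim-dropFirst record { dim = suc _ } = refl

  ∈-dropFirst⇒∈ : ∀ {m} (S : Subspace m) {v : Vec m} → v ∈ dropFirst S → v ∈ S
  ∈-dropFirst⇒∈ record { dim = zero } v∈S = v∈S
  ∈-dropFirst⇒∈ record { dim = suc d ; basis = b } (a , v≈a·b) =
    prependZero a , λ i → ≈-trans (v≈a·b i) (≈-sym (lincomb-prependZero d a b i))

module _ {a : Level} where
  dropAtFirstPositive : ∀ {l} {F : Fin l → Set a} →
    (∀ {i} → F i → ℕ) → (∀ {i} → F i → F i) → (∀ i → F i) → ∀ i → F i
  dropAtFirstPositive {zero}  size drop x = x
  dropAtFirstPositive {suc l} size drop x zero with size (x zero)
  ... | zero  = x zero
  ... | suc _ = drop (x zero)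
  dropAtFirstPositive {suc l} size drop x (suc i) with size (x zero)
  ... | zero  = dropAtFirstPositive size drop (x ∘ suc) i
  ... | suc _ = x (suc i)

  dropAtFirstPositive-pointwise : ∀ {l} {F : Fin l → Set a}
    (size : ∀ {i} → F i → ℕ) (drop : ∀ {i} → F i → F i) (x : ∀ i → F i) (i : Fin l) →
    let y = dropAtFirstPositive size drop x in y i ≡ x i ⊎ y i ≡ drop (x i)
  dropAtFirstPositive-pointwise {suc l} size drop x zero with size (x zero)
  ... | zero  = inj₁ refl
  ... | suc _ = inj₂ refl
  dropAtFirstPositive-pointwise {suc l} size drop x (suc i) with size (x zero)
  ... | zero  = dropAtFirstPositive-pointwise size drop (x ∘ suc) i
  ... | suc _ = inj₁ refl

  Σℕ-dropAtFirstPositive : ∀ {l} {F : Fin l → Set a}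
    (size : ∀ {i} → F i → ℕ) (drop : ∀ {i} → F i → F i) →
    (∀ {i} (y : F i) → size (drop y) ≡ pred (size y)) →
    (x : ∀ i → F i) → Σℕ l (size ∘ dropAtFirstPositive size drop x) ≡ pred (Σℕ l (size ∘ x))
  Σℕ-dropAtFirstPositive {zero}  size drop size-drop x = refl
  Σℕ-dropAtFirstPositive {suc l} size drop size-drop x with size (x zero) in eq
  ... | zero  = trans (cong (_+ℕ Σℕ l (size ∘ dropAtFirstPositive size drop (x ∘ suc))) eq)
                      (Σℕ-dropAtFirstPositive size drop size-drop (x ∘ suc))
  ... | suc _ = cong (_+ℕ Σℕ l (size ∘ x ∘ suc)) (trans (size-drop (x zero)) (cong pred eq))

module _ {c ℓ : Level} {l : ℕ} {K : Fin l → FiniteField c ℓ} {n : Fin l → ℕ} where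
  open SumMatroid l K n
  open LinAlg using (Subspace)

  private
    dimₖ : ∀ {i} → Subspace (K i) (n i) → ℕ
    dimₖ = Subspace.dim

    dropFirstₖ : ∀ {i} → Subspace (K i) (n i) → Subspace (K i) (n i)
    dropFirstₖ {i} = dropFirst (K i)

  shrink : Tuple → Tuple
  shrink = dropAtFirstPositive dimₖ dropFirstₖ

  Rk-shrink : ∀ L → Rk (shrink L) ≡ pred (Rk L)
  Rk-shrink = Σℕ-dropAtFirstPositive dimₖ dropFirstₖ (λ {i} → dim-dropFirst (K i))

  shrink-⊆ : ∀ L → shrink L ⊆ L
  shrink-⊆ L i v v∈shrink with dropAtFirstPositive-pointwise dimₖ dropFirstₖ L i
  ... | inj₁ same    = subst (LinAlg._∈_ (K i) v) same v∈shrink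
  ... | inj₂ dropped =
    ∈-dropFirst⇒∈ (K i) (L i) (subst (LinAlg._∈_ (K i) v) dropped v∈shrink)

  Rk-shrink-< : ∀ L → 0 < Rk L → Rk (shrink L) < Rk L
  Rk-shrink-< L 0<Rk = subst (_< Rk L) (sym (Rk-shrink L)) (pred< 0<Rk)
    where
    pred< : ∀ {m} → 0 < m → pred m < m
    pred< {suc m} _ = n<1+n m

  module _ (ρ : Tuple → ℕ) (ρ-mono : ∀ L L' → L ⊆ L' → ρ L ≤ ρ L') where

    η-shrink : ∀ L {i} → i < η ρ L → i ≤ η ρ (shrink L)
    η-shrink L {i} i<η = begin
      i                                 ≤⟨ <⇒≤pred i<η ⟩
      pred (Rk L ∸ ρ L)                 ≡⟨ pred[m∸n]≡m∸[1+n] (Rk L) (ρ L) ⟩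
      Rk L ∸ suc (ρ L)                  ≡⟨ sym (∸-+-assoc (Rk L) 1 (ρ L)) ⟩
      pred (Rk L) ∸ ρ L                 ≡⟨ cong (_∸ ρ L) (sym (Rk-shrink L)) ⟩
      Rk (shrink L) ∸ ρ L               ≤⟨ ∸-monoʳ-≤ (Rk (shrink L)) (ρ-mono _ _ (shrink-⊆ L)) ⟩
      Rk (shrink L) ∸ ρ (shrink L)      ∎
      where open ≤-Reasoning

    nullity-attained-below : ∀ L i → i < η ρ L → ∃ λ L' → η ρ L' ≡ i × Rk L' < Rk L
    nullity-attained-below L i = go L (<-wellFounded (Rk L))
      where
      go : ∀ L → Acc _<_ (Rk L) → i < η ρ L → ∃ λ L' → η ρ L' ≡ i × Rk L' < Rk L
      go L (acc rs) i<η = [ descend , stop ] (m≤n⇒m<n∨m≡n (η-shrink L i<η))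
        where
        Rk-shrink-<L : Rk (shrink L) < Rk L
        Rk-shrink-<L = Rk-shrink-< L (<-≤-trans (≤-<-trans z≤n i<η) (m∸n≤m (Rk L) (ρ L)))

        stop : i ≡ η ρ (shrink L) → ∃ λ L' → η ρ L' ≡ i × Rk L' < Rk L
        stop i≡η' = shrink L , sym i≡η' , Rk-shrink-<L

        descend : i < η ρ (shrink L) → ∃ λ L' → η ρ L' ≡ i × Rk L' < Rk L
        descend i<η' =
          let L' , ηL'≡i , Rk<  = go (shrink L) (rs Rk-shrink-<L) i<η'
          in  L' , ηL'≡i , <-trans Rk< Rk-shrink-<L

proposition42 : {c ℓ : Level} (l : ℕ) (K : Fin l → FiniteField c ℓ) (n : Fin l → ℕ) →
    1 ≤ l → (∀ i → 1 ≤ n i) →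
    let open SumMatroid l K n in
    (ρ : Tuple → ℕ) → IsSumMatroid ρ →
    (E : Tuple) → IsWhole E →
    ∀ i j d d' → 1 ≤ i → i < j → j ≤ η ρ E →
    IsGenWeight ρ i d → IsGenWeight ρ j d' → d < d'
proposition42 l K n _ _ ρ isSumMatroid _ _ i _ _ _ _ i<j _
  (_ , d-minimal) ((L , ηL≡j , RkL≡d') , _) =
  let L' , ηL'≡i , RkL'<RkL = nullity-attained-below ρ (IsSumMatroid.R2 isSumMatroid) L i
                                (subst (i <_) (sym ηL≡j) i<j)
  in  ≤-<-trans (d-minimal L' ηL'≡i) (subst (Rk L' <_) RkL≡d' RkL'<RkL)
  where open SumMatroid l K n
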